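{- Let $(L,\vee,\wedge,{\sim},{^*},0,1)$ be a regular pseudocomplemented Kleene algebra defined on an algebraic lattice, and let $x,y\in\mathcal{A}$. Then: (a) $y\in\langle x\rangle\iff g(y)\in\langle x\rangle\iff x=y$; (b) $\langle x\rangle=\{x\}\iff g(x)=x$; (c) $\langle x\rangle\cap\langle y\rangle\ne\emptyset\iff x\simeq y$.
   Context: A Kleene algebra $(L,\vee,\wedge,{\sim},0,1)$ is a bounded distributive lattice with ${\sim}{\sim}x=x$, $x\le y\iff{\sim}y\le{\sim}x$, and $x\wedge{\sim}x\le y\vee{\sim}y$. It is pseudocomplemented if every $x$ has a pseudocomplement $x^*$ ($x\wedge z=0\iff z\le x^*$); set $x^+:={\sim}(({\sim}x)^*)$; it is regular if $x^*=y^*$ and $x^+=y^+$ imply $x=y$. A lattice is algebraic if complete and each element is a join of compact elements. $\mathcal{J}$ is the set of completely join-irreducible elements of $L$, $\mathcal{A}$ the set of atoms. For $j\in\mathcal{J}$, $g(j)=\bigwedge\{x\in L\mid x\not\le{\sim}j\}\in\mathcal{J}$. Define the relation $\simeq$ on $\mathcal{A}$ by $x\simeq y\iff x\le g(y)$, and for $x\in\mathcal{A}$ let $\langle x\rangle=\{x\vee y\mid y\in\mathcal{A},\ y\simeq x\}\cup\{g(x)\}$. -}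

module Defs where

open import Level using (Level; suc; _⊔_)
open import Data.Product using (_×_; Σ; ∃; ∃-syntax; _,_)
open import Data.Sum using (_⊎_)
open import Data.List using (List; foldr)
open import Data.List.Relation.Unary.All using (All)
open import Relation.Nullary using (¬_)
open import Relation.Unary using (Pred)
open import Relation.Binary.PropositionalEquality using (_≡_)
open import Relation.Binary.Lattice.Structures using (IsBoundedLattice)
open import Algebra.Definitions using (_DistributesOverˡ_)
open import Function.Bundles using (_⇔_)

-- Convention: the carrier equality is propositional equality (a lattice is a set).

module _ {ℓ : Level} {L : Set ℓ} (_≤_ : L → L → Set ℓ) where

  IsSup : ∀ {p} → Pred L p → L → Set (ℓ ⊔ p)
  IsSup S s = (∀ x → S x → x ≤ s) × (∀ u → (∀ x → S x → x ≤ u) → s ≤ u)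

  IsInf : ∀ {p} → Pred L p → L → Set (ℓ ⊔ p)
  IsInf S m = (∀ x → S x → m ≤ x) × (∀ u → (∀ x → S x → u ≤ x) → u ≤ m)

record PKleeneAlgebra (ℓ : Level) : Set (suc ℓ) where
  infix  4 _≤_
  infixr 6 _∨_
  infixr 7 _∧_
  field
    Carrier  : Set ℓ
    _≤_      : Carrier → Carrier → Set ℓ
    _∨_ _∧_  : Carrier → Carrier → Carrier
    𝟘 𝟙      : Carrier
    ∼_       : Carrier → Carrier
    _*       : Carrier → Carrier
    isBoundedLattice : IsBoundedLattice _≡_ _≤_ _∨_ _∧_ 𝟙 𝟘
    ∧-distribˡ-∨     : _DistributesOverˡ_ _≡_ _∧_ _∨_
    ∼-involutive : ∀ x → ∼ (∼ x) ≡ x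
    ∼-antitone   : ∀ x y → (x ≤ y) ⇔ (∼ y ≤ ∼ x)
    kleene       : ∀ x y → x ∧ ∼ x ≤ y ∨ ∼ y
    pseudocomplement : ∀ x z → (x ∧ z ≡ 𝟘) ⇔ (z ≤ x *)
    ⋁ ⋀      : Pred Carrier ℓ → Carrier
    ⋁-sup    : ∀ S → IsSup _≤_ S (⋁ S)
    ⋀-inf    : ∀ S → IsInf _≤_ S (⋀ S)

  _⁺ : Carrier → Carrier
  x ⁺ = ∼ ((∼ x) *)

  IsRegular : Set ℓ
  IsRegular = ∀ x y → x * ≡ y * → x ⁺ ≡ y ⁺ → x ≡ y

  ⋁list : List Carrier → Carrier
  ⋁list = foldr _∨_ 𝟘

  IsCompact : Carrier → Set (suc ℓ)
  IsCompact c = ∀ (S : Pred Carrier ℓ) s → IsSup _≤_ S s → c ≤ s →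
                ∃[ F ] (All S F × c ≤ ⋁list F)

  IsAlgebraic : Set (suc ℓ)
  IsAlgebraic = ∀ x → IsSup _≤_ (λ c → IsCompact c × c ≤ x) x

  IsCJI : Carrier → Set (suc ℓ)
  IsCJI j = ∀ (S : Pred Carrier ℓ) → IsSup _≤_ S j → S j

  IsAtom : Carrier → Set ℓ
  IsAtom a = ¬ (a ≡ 𝟘) × (∀ y → y ≤ a → (y ≡ 𝟘) ⊎ (y ≡ a))

  g : Carrier → Carrier
  g j = ⋀ (λ x → ¬ (x ≤ ∼ j))

  _≃_ : Carrier → Carrier → Set ℓ
  x ≃ y = x ≤ g y

  ⟨_⟩ : Carrier → Pred Carrier ℓ
  ⟨ x ⟩ z = (∃[ y ] (IsAtom y × y ≃ x × z ≡ x ∨ y)) ⊎ (z ≡ g x)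

-- On an algebraic lattice every atom x is compact, and compactness forces
-- g(x) ≰ ∼x; together with x ≤ g(g(x)) this makes g an involution on atoms.
-- Every element of ⟨ x ⟩ lies in the interval [x , g x], and all three parts
-- follow from these facts: (c) because y ≤ z ≤ g x is symmetric under g, and
-- (a) because g y ≤ g x reflects to x ≤ y.
module Submission where

open import Defs
open import Level using (Level)
open import Data.Product using (_×_; ∃-syntax; _,_; proj₁; proj₂)
open import Data.Sum using (inj₁; inj₂)
open import Data.List using ([]; _∷_)
open import Data.List.Relation.Unary.All as All using (All; []; _∷_)
open import Relation.Nullary using (¬_; Dec; yes; no; contradiction)
open import Relation.Nullary.Decidable using (decidable-stable)
open import Relation.Binary.PropositionalEquality using (_≡_; refl; sym; trans; cong₂; subst)
open import Relation.Binary.Lattice.Bundles using (BoundedLattice)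
open import Function.Bundles using (_⇔_; mk⇔; Equivalence)

module PKleeneAlgebraProperties {ℓ : Level} (K : PKleeneAlgebra ℓ) where
  open PKleeneAlgebra K

  boundedLattice : BoundedLattice ℓ ℓ ℓ
  boundedLattice = record { isBoundedLattice = isBoundedLattice }

  open BoundedLattice boundedLattice
    using (x≤x∨y; y≤x∨y; ∨-least; x∧y≤x; x∧y≤y; ∧-greatest; minimum; antisym;
           reflexive; poset; joinSemilattice; meetSemilattice)
    renaming (refl to ≤-refl; trans to ≤-trans)
  open import Relation.Binary.Lattice.Properties.JoinSemilattice joinSemilattice
    using (∨-comm; ∨-idempotent)
  open import Relation.Binary.Lattice.Properties.MeetSemilattice meetSemilattice
    using (∧-comm)
  open import Relation.Binary.Reasoning.PartialOrder poset
  open Equivalence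

  ≤𝟘⇒≡𝟘 : ∀ {a} → a ≤ 𝟘 → a ≡ 𝟘
  ≤𝟘⇒≡𝟘 a≤𝟘 = antisym a≤𝟘 (minimum _)

  ≤-disjoint⇒≡𝟘 : ∀ {a b} → a ≤ b → a ∧ b ≡ 𝟘 → a ≡ 𝟘
  ≤-disjoint⇒≡𝟘 {a} {b} a≤b a∧b≡𝟘 = ≤𝟘⇒≡𝟘 (begin
    a      ≤⟨ ∧-greatest ≤-refl a≤b ⟩
    a ∧ b  ≡⟨ a∧b≡𝟘 ⟩
    𝟘      ∎)

  ∼-mono-≤ : ∀ {a b} → a ≤ b → ∼ b ≤ ∼ a
  ∼-mono-≤ {a} {b} = to (∼-antitone a b)

  ∼-cancel-≤ : ∀ {a b} → ∼ b ≤ ∼ a → a ≤ b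
  ∼-cancel-≤ {a} {b} = from (∼-antitone a b)

  ≤∼-sym : ∀ {a b} → a ≤ ∼ b → b ≤ ∼ a
  ≤∼-sym {a} {b} a≤∼b = subst (_≤ ∼ a) (∼-involutive b) (∼-mono-≤ a≤∼b)

  ∼≤-sym : ∀ {a b} → ∼ a ≤ b → ∼ b ≤ a
  ∼≤-sym {a} {b} ∼a≤b = subst (∼ b ≤_) (∼-involutive a) (∼-mono-≤ ∼a≤b)

  disjoint⇒≤∼ : ∀ {a b} → a ∧ b ≡ 𝟘 → b ≤ ∼ a
  disjoint⇒≤∼ {a} {b} a∧b≡𝟘 = begin
    b                         ≤⟨ ∧-greatest ≤-refl (∼b∨∼a-top b) ⟩
    b ∧ (∼ b ∨ ∼ a)           ≡⟨ ∧-distribˡ-∨ b (∼ b) (∼ a) ⟩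
    (b ∧ ∼ b) ∨ (b ∧ ∼ a)     ≤⟨ ∨-least b∧∼b≤∼a (x∧y≤y b (∼ a)) ⟩
    ∼ a                       ∎
    where
    b∧a≤∼a : b ∧ a ≤ ∼ a
    b∧a≤∼a = ≤-trans (reflexive (trans (∧-comm b a) a∧b≡𝟘)) (minimum (∼ a))

    ∼b∨∼a-top : ∀ c → c ≤ ∼ b ∨ ∼ a
    ∼b∨∼a-top c = ∼-cancel-≤ (≤-trans ∼[∼b∨∼a]≤𝟘 (minimum (∼ c)))
      where
      ∼[∼b∨∼a]≤𝟘 : ∼ (∼ b ∨ ∼ a) ≤ 𝟘
      ∼[∼b∨∼a]≤𝟘 = begin
        ∼ (∼ b ∨ ∼ a)  ≤⟨ ∧-greatest (∼≤-sym (y≤x∨y (∼ b) (∼ a)))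
                                     (∼≤-sym (x≤x∨y (∼ b) (∼ a))) ⟩
        a ∧ b          ≡⟨ a∧b≡𝟘 ⟩
        𝟘              ∎

    b∧∼b≤∼a : b ∧ ∼ b ≤ ∼ a
    b∧∼b≤∼a = begin
      b ∧ ∼ b                ≤⟨ ∧-greatest (x∧y≤x b (∼ b)) (kleene b a) ⟩
      b ∧ (a ∨ ∼ a)          ≡⟨ ∧-distribˡ-∨ b a (∼ a) ⟩
      (b ∧ a) ∨ (b ∧ ∼ a)    ≤⟨ ∨-least b∧a≤∼a (x∧y≤y b (∼ a)) ⟩
      ∼ a                    ∎

  disjoint-⋁list : ∀ {a} F → All (λ w → a ∧ w ≡ 𝟘) F → a ∧ ⋁list F ≡ 𝟘
  disjoint-⋁list {a} []      []                 = ≤𝟘⇒≡𝟘 (x∧y≤y a 𝟘)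
  disjoint-⋁list {a} (w ∷ F) (a∧w≡𝟘 ∷ a∧F≡𝟘) = begin-equality
    a ∧ (w ∨ ⋁list F)           ≡⟨ ∧-distribˡ-∨ a w (⋁list F) ⟩
    (a ∧ w) ∨ (a ∧ ⋁list F)     ≡⟨ cong₂ _∨_ a∧w≡𝟘 (disjoint-⋁list F a∧F≡𝟘) ⟩
    𝟘 ∨ 𝟘                       ≡⟨ ∨-idempotent 𝟘 ⟩
    𝟘                           ∎

  atom-≤-atom⇒≡ : ∀ {a b} → IsAtom a → IsAtom b → b ≤ a → b ≡ a
  atom-≤-atom⇒≡ (_ , below-a) (b≢𝟘 , _) b≤a with below-a _ b≤a
  ... | inj₁ b≡𝟘 = contradiction b≡𝟘 b≢𝟘
  ... | inj₂ b≡a = b≡a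

  atom-≰⇒disjoint : ∀ {a z} → IsAtom a → ¬ a ≤ z → a ∧ z ≡ 𝟘
  atom-≰⇒disjoint {a} {z} (_ , below-a) a≰z with below-a (a ∧ z) (x∧y≤x a z)
  ... | inj₁ a∧z≡𝟘 = a∧z≡𝟘
  ... | inj₂ a∧z≡a = contradiction (subst (_≤ z) a∧z≡a (x∧y≤y a z)) a≰z

  atom-≰⇒≤∼ : ∀ {a z} → IsAtom a → ¬ a ≤ z → z ≤ ∼ a
  atom-≰⇒≤∼ at a≰z = disjoint⇒≤∼ (atom-≰⇒disjoint at a≰z)

  atom-≤? : ∀ {a} → IsAtom a → ∀ z → Dec (a ≤ z)
  atom-≤? {a} (a≢𝟘 , below-a) z with below-a (a ∧ z) (x∧y≤x a z)
  ... | inj₂ a∧z≡a = yes (subst (_≤ z) a∧z≡a (x∧y≤y a z))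
  ... | inj₁ a∧z≡𝟘 = no λ a≤z → a≢𝟘 (≤-disjoint⇒≡𝟘 a≤z a∧z≡𝟘)

  g-lowerBound : ∀ {j z} → ¬ z ≤ ∼ j → g j ≤ z
  g-lowerBound {j} {z} = proj₁ (⋀-inf (λ x → ¬ x ≤ ∼ j)) z

  g-greatest : ∀ {j u} → (∀ z → ¬ z ≤ ∼ j → u ≤ z) → u ≤ g j
  g-greatest {j} {u} = proj₂ (⋀-inf (λ x → ¬ x ≤ ∼ j)) u

  g-antitone : ∀ {a b} → a ≤ b → g b ≤ g a
  g-antitone a≤b = g-greatest λ z z≰∼a →
    g-lowerBound (λ z≤∼b → z≰∼a (≤-trans z≤∼b (∼-mono-≤ a≤b)))

  atom⇒≤g : ∀ {a} → IsAtom a → a ≤ g a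
  atom⇒≤g at = g-greatest λ z z≰∼a →
    decidable-stable (atom-≤? at z) (λ a≰z → z≰∼a (atom-≰⇒≤∼ at a≰z))

  atom⇒≤gg : ∀ {a} → IsAtom a → a ≤ g (g a)
  atom⇒≤gg at = g-greatest λ z z≰∼ga →
    decidable-stable (atom-≤? at z) λ a≰z →
      z≰∼ga (≤∼-sym (g-lowerBound (λ ∼z≤∼a → a≰z (∼-cancel-≤ ∼z≤∼a))))

  ≃-sym : ∀ {x y} → IsAtom y → x ≃ y → y ≃ x
  ≃-sym ay x≤gy = ≤-trans (atom⇒≤gg ay) (g-antitone x≤gy)

  -- The compact element a lies below ⋁ { w | a ≰ w } once g a ≤ ∼ a,
  -- hence below a finite join of elements disjoint from it.
  compact-atom⇒g≰∼ : ∀ {a} → IsCompact a → IsAtom a → ¬ g a ≤ ∼ a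
  compact-atom⇒g≰∼ {a} compact at@(a≢𝟘 , _) ga≤∼a =
    a≢𝟘 (finite-cover⇒≡𝟘 (compact S (⋁ S) (⋁-sup S) a≤⋁S))
    where
    S = λ w → ¬ a ≤ w

    ∼⋁S≤ga : ∼ ⋁ S ≤ g a
    ∼⋁S≤ga = g-greatest λ z z≰∼a →
      ∼≤-sym (proj₁ (⋁-sup S) (∼ z) (λ a≤∼z → z≰∼a (≤∼-sym a≤∼z)))

    a≤⋁S : a ≤ ⋁ S
    a≤⋁S = ∼-cancel-≤ (≤-trans ∼⋁S≤ga ga≤∼a)

    finite-cover⇒≡𝟘 : ∃[ F ] (All S F × a ≤ ⋁list F) → a ≡ 𝟘
    finite-cover⇒≡𝟘 (F , F⊆S , a≤⋁F) =
      ≤-disjoint⇒≡𝟘 a≤⋁F (disjoint-⋁list F (All.map (atom-≰⇒disjoint at) F⊆S))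

  -- A non-compact atom would have only 𝟘 below it among compact elements.
  algebraic-atom⇒¬¬compact : IsAlgebraic → ∀ {a} → IsAtom a → ¬ ¬ IsCompact a
  algebraic-atom⇒¬¬compact algebraic {a} (a≢𝟘 , below-a) ¬compact =
    a≢𝟘 (≤𝟘⇒≡𝟘 (proj₂ (algebraic a) 𝟘 compact≤a⇒≤𝟘))
    where
    compact≤a⇒≤𝟘 : ∀ c → IsCompact c × c ≤ a → c ≤ 𝟘
    compact≤a⇒≤𝟘 c (compact , c≤a) with below-a c c≤a
    ... | inj₁ c≡𝟘 = reflexive c≡𝟘
    ... | inj₂ refl = contradiction compact ¬compact

  module _ (algebraic : IsAlgebraic) where

    g≰∼ : ∀ {a} → IsAtom a → ¬ g a ≤ ∼ a
    g≰∼ at ga≤∼a =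
      algebraic-atom⇒¬¬compact algebraic at (λ compact → compact-atom⇒g≰∼ compact at ga≤∼a)

    gg≤atom : ∀ {a} → IsAtom a → g (g a) ≤ a
    gg≤atom at = g-lowerBound (λ a≤∼ga → g≰∼ at (≤∼-sym a≤∼ga))

    g-cancel-≤ : ∀ {x y} → IsAtom x → IsAtom y → g y ≤ g x → x ≤ y
    g-cancel-≤ {x} {y} ax ay gy≤gx = begin
      x          ≤⟨ atom⇒≤gg ax ⟩
      g (g x)    ≤⟨ g-antitone gy≤gx ⟩
      g (g y)    ≤⟨ gg≤atom ay ⟩
      y          ∎

  ⟨⟩-self : ∀ {x} → IsAtom x → ⟨ x ⟩ x
  ⟨⟩-self {x} ax = inj₁ (x , ax , atom⇒≤g ax , sym (∨-idempotent x))

  ⟨⟩-lowerBound : ∀ {x z} → IsAtom x → ⟨ x ⟩ z → x ≤ z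
  ⟨⟩-lowerBound {x} _  (inj₁ (a , _ , _ , refl)) = x≤x∨y x a
  ⟨⟩-lowerBound     ax (inj₂ refl)               = atom⇒≤g ax

  ⟨⟩-upperBound : ∀ {x z} → IsAtom x → ⟨ x ⟩ z → z ≤ g x
  ⟨⟩-upperBound ax (inj₁ (_ , _ , a≤gx , refl)) = ∨-least (atom⇒≤g ax) a≤gx
  ⟨⟩-upperBound _  (inj₂ refl)                  = ≤-refl

  ⟨⟩-atom⇒≡ : ∀ {x y} → IsAtom x → IsAtom y → ⟨ x ⟩ y → x ≡ y
  ⟨⟩-atom⇒≡ ax ay y∈⟨x⟩ = atom-≤-atom⇒≡ ay ax (⟨⟩-lowerBound ax y∈⟨x⟩)

  ⟨⟩-g-atom⇒≡ : IsAlgebraic → ∀ {x y} → IsAtom x → IsAtom y → ⟨ x ⟩ (g y) → x ≡ y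
  ⟨⟩-g-atom⇒≡ algebraic ax ay gy∈⟨x⟩ =
    atom-≤-atom⇒≡ ay ax (g-cancel-≤ algebraic ax ay (⟨⟩-upperBound ax gy∈⟨x⟩))

  ⟨⟩-singleton : ∀ {x} → IsAtom x → g x ≡ x → ∀ z → ⟨ x ⟩ z → z ≡ x
  ⟨⟩-singleton ax gx≡x z z∈⟨x⟩ =
    antisym (subst (z ≤_) gx≡x (⟨⟩-upperBound ax z∈⟨x⟩)) (⟨⟩-lowerBound ax z∈⟨x⟩)

  ⟨⟩-meet⇒≃ : ∀ {x y z} → IsAtom x → IsAtom y → ⟨ x ⟩ z → ⟨ y ⟩ z → x ≃ y
  ⟨⟩-meet⇒≃ ax ay z∈⟨x⟩ z∈⟨y⟩ =
    ≃-sym ax (≤-trans (⟨⟩-lowerBound ay z∈⟨y⟩) (⟨⟩-upperBound ax z∈⟨x⟩))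

  ≃⇒⟨⟩-meet : ∀ {x y} → IsAtom x → IsAtom y → x ≃ y → ⟨ x ⟩ (y ∨ x) × ⟨ y ⟩ (y ∨ x)
  ≃⇒⟨⟩-meet {x} {y} ax ay x≃y =
    inj₁ (y , ay , ≃-sym ay x≃y , ∨-comm y x) , inj₁ (x , ax , x≃y , refl)

lemma4p6 : ∀ {ℓ : Level} (K : PKleeneAlgebra ℓ) → let open PKleeneAlgebra K in
    IsRegular → IsAlgebraic → ∀ x y → IsAtom x → IsAtom y →
    (((⟨ x ⟩ y) ⇔ (⟨ x ⟩ (g y))) × ((⟨ x ⟩ (g y)) ⇔ (x ≡ y)))
    × ((∀ z → (⟨ x ⟩ z) ⇔ (z ≡ x)) ⇔ (g x ≡ x))
    × ((∃[ z ] (⟨ x ⟩ z × ⟨ y ⟩ z)) ⇔ (x ≃ y))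
lemma4p6 K _ algebraic x y ax ay =
  ( mk⇔ (λ y∈⟨x⟩ → x≡y⇒gy∈⟨x⟩ (⟨⟩-atom⇒≡ ax ay y∈⟨x⟩))
        (λ gy∈⟨x⟩ → x≡y⇒y∈⟨x⟩ (gy∈⟨x⟩⇒x≡y gy∈⟨x⟩))
  , mk⇔ gy∈⟨x⟩⇒x≡y x≡y⇒gy∈⟨x⟩ )
  , mk⇔ (λ ⟨x⟩≡[x] → Equivalence.to (⟨x⟩≡[x] (g x)) (inj₂ refl))
        (λ gx≡x z → mk⇔ (⟨⟩-singleton ax gx≡x z) (λ { refl → ⟨⟩-self ax }))
  , mk⇔ (λ (z , z∈⟨x⟩ , z∈⟨y⟩) → ⟨⟩-meet⇒≃ ax ay z∈⟨x⟩ z∈⟨y⟩)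
        (λ x≃y → y ∨ x , ≃⇒⟨⟩-meet ax ay x≃y)
  where
  open PKleeneAlgebra K
  open PKleeneAlgebraProperties K

  gy∈⟨x⟩⇒x≡y : ⟨ x ⟩ (g y) → x ≡ y
  gy∈⟨x⟩⇒x≡y = ⟨⟩-g-atom⇒≡ algebraic ax ay

  x≡y⇒gy∈⟨x⟩ : x ≡ y → ⟨ x ⟩ (g y)
  x≡y⇒gy∈⟨x⟩ refl = inj₂ refl

  x≡y⇒y∈⟨x⟩ : x ≡ y → ⟨ x ⟩ y
  x≡y⇒y∈⟨x⟩ refl = ⟨⟩-self ax
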